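{- Let $n,k,d$ be non-negative integers with $n\geq 2$, and let $G$ be a bipartite $(n,k,d)$-graph. Then for every edge $e$ of $G$, the graph $G-e$ is an $(n-2,k,d)$-graph.
   Context: All graphs are finite, undirected and simple. A $k$-matching is a matching with exactly $k$ edges. For a non-negative integer $d$, a defect-$d$ matching of a graph $H$ is a matching covering exactly $|V(H)|-d$ vertices of $H$. A matching $M$ extends to a matching $M'$ if $M\subseteq M'$. Let $n,k,d$ be non-negative integers. A graph $G$ is an $(n,k,d)$-graph if $|V(G)|\geq n+2k+d+2$, $|V(G)|-n-d$ is even, and for every set $S$ of $n$ vertices of $G$, the graph $H=G-S$ contains a $k$-matching and every $k$-matching of $H$ can be extended to a defect-$d$ matching of $H$. -}

module Defs where

open import Data.Nat using (ℕ; _+_; _*_; _∸_; _≥_)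
open import Data.Nat.Divisibility using (_∣_)
open import Data.Bool using (Bool)
open import Data.Fin using (Fin)
open import Data.Fin.Subset using (Subset; _∈_; ∁; ∣_∣)
open import Data.Product using (_×_; _,_; Σ; ∃)
open import Data.Sum using (_⊎_)
open import Data.List using (List; []; _∷_; length; concatMap)
open import Data.List.Relation.Unary.All using (All)
open import Data.List.Relation.Unary.Any using (Any)
open import Data.List.Relation.Unary.Unique.Propositional using (Unique)
open import Relation.Binary.PropositionalEquality using (_≡_; _≢_)
open import Relation.Nullary using (¬_)

record Graph : Set₁ where
  field
    N     : ℕ
    _~_   : Fin N → Fin N → Set
    sym   : ∀ {x y} → x ~ y → y ~ x
    irrefl : ∀ {x} → ¬ (x ~ x)
open Graph public

Bipartite : Graph → Set
Bipartite G = Σ (Fin (N G) → Bool) λ c → ∀ {x y} → _~_ G x y → c x ≢ c y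

SamePair : ∀ {N} → (Fin N × Fin N) → (Fin N × Fin N) → Set
SamePair (x , y) (u , v) = (x ≡ u × y ≡ v) ⊎ (x ≡ v × y ≡ u)

removeEdge : (G : Graph) → Fin (N G) → Fin (N G) → Graph
removeEdge G u v = record
  { N = N G
  ; _~_ = λ x y → _~_ G x y × ¬ SamePair (x , y) (u , v)
  ; sym = λ { (a , b) → sym G a , λ { (_⊎_.inj₁ (p , q)) → b (_⊎_.inj₂ (q , p))
                                     ; (_⊎_.inj₂ (p , q)) → b (_⊎_.inj₁ (q , p)) } }
  ; irrefl = λ { (a , _) → irrefl G a }
  }

-- Endpoints of a list of edges (each edge an ordered pair representing {u,v}).
endpoints : ∀ {N} → List (Fin N × Fin N) → List (Fin N)
endpoints = concatMap (λ { (u , v) → u ∷ v ∷ [] })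

-- M is a matching of the induced subgraph H = G[A]: every listed pair is an
-- edge of G with both ends in A, and all endpoints are pairwise distinct
-- (so edges are disjoint and no edge is listed twice).
IsMatching : (G : Graph) → Subset (N G) → List (Fin (N G) × Fin (N G)) → Set
IsMatching G A M =
  All (λ { (u , v) → _~_ G u v × u ∈ A × v ∈ A }) M × Unique (endpoints M)

Extends : ∀ {N} → List (Fin N × Fin N) → List (Fin N × Fin N) → Set
Extends M M' = All (λ e → Any (SamePair e) M') M

-- Number of vertices covered by a matching M is length (endpoints M) = 2|M|.
-- Defect-d matching of H = G[A]: covers exactly |A| - d vertices.
IsDefectMatching : (G : Graph) → Subset (N G) → ℕ → List (Fin (N G) × Fin (N G)) → Set
IsDefectMatching G A d M = IsMatching G A M × ∣ A ∣ ≡ length (endpoints M) + d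

IsNKDGraph : ℕ → ℕ → ℕ → Graph → Set
IsNKDGraph n k d G =
  (N G ≥ n + 2 * k + d + 2)
  × (2 ∣ (N G ∸ n ∸ d))
  × (∀ (S : Subset (N G)) → ∣ S ∣ ≡ n →
       (∃ λ M → IsMatching G (∁ S) M × length M ≡ k)
       × (∀ M → IsMatching G (∁ S) M → length M ≡ k →
            ∃ λ M' → IsDefectMatching G (∁ S) d M' × Extends M M'))

module Submission where

-- Let e = uv and let S be a set of n − 2 vertices of G. Given a k-matching M of (G − e) − S, pick w outside
-- S ∪ V(M), taking w = u whenever u itself is outside S ∪ V(M). For every other x outside S ∪ V(M) the set
-- T = S ∪ {w, x} has n vertices, and an edge of G − T that misses V(M) cannot be e. So G − T provides a
-- k-matching of (G − e) − S (take M empty), and extending M to a defect-d matching of G − T and discarding M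
-- leaves a matching X_x of H = (G − e) − S − V(M) that misses w and x and whose size r does not depend on x.
-- Counting shows that these matchings are not empty and that what is needed is an (r + 1)-matching of H. Take an
-- edge xy of one of them; then X_x and X_y are r-matchings of H missing x and y respectively, and since H is
-- bipartite the alternating path of X_x ∪ X_y from x either produces an (r + 1)-matching or moves X_y off x
-- while keeping it off y, after which xy can be added.

open import Defs hiding (sym)
open import Data.Nat using (ℕ; zero; suc; _+_; _*_; _∸_; _≤_; _<_; _≥_; s≤s; s≤s⁻¹)
open import Data.Nat.Properties
  using ( ≤-reflexive; ≤-trans; n≤1+n; <-irrefl; *-suc; suc-injective; +-identityʳ; m≤m+n; m≤n+m
        ; m+n≤o⇒m≤o; m+n≤o⇒n≤o; m+n≤o⇒m≤o∸n; m+[n∸m]≡n; m+n∸m≡n; +-∸-assoc; m+1+n≰m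
        ; +-cancelˡ-≡; +-cancelʳ-≡; *-cancelˡ-≡)
open import Data.Nat.Divisibility using (_∣_; ∣m∣n⇒∣m+n; ∣-refl)
open import Data.Nat.Tactic.RingSolver using (solve-∀)
open import Data.Bool using (Bool)
open import Data.Bool.Properties using (¬-not)
open import Data.Fin using (Fin; zero; suc)
open import Data.Fin.Properties using (_≟_)
open import Data.Fin.Subset using (Subset; inside; outside; ⁅_⁆; _∪_; _-_; ∣_∣; ∁; Nonempty)
  renaming (_∈_ to _∈ₛ_; _∉_ to _∉ₛ_)
open import Data.Fin.Subset.Properties
  using ( ∪-identityʳ; p─⊥≡p; p─q⊆p; nonempty?; Empty-unique; ∣⊥∣≡0; ∣∁p∣≡n∸∣p∣; _∈?_
        ; x∈∁p⇒x∉p; x∉p⇒x∈∁p; x∈p∪q⁺; x∈p∪q⁻; x∈⁅x⁆; x∈⁅y⁆⇒x≡y)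
open import Data.Vec using (_∷_; here; there)
open import Data.List using (List; []; _∷_; length; _++_)
open import Data.List.Properties using (length-++; concatMap-++)
open import Data.List.Relation.Unary.All as All using (All; []; _∷_)
open import Data.List.Relation.Unary.All.Properties using (¬Any⇒All¬; All¬⇒¬Any) renaming (++⁺ to All-++⁺)
open import Data.List.Relation.Unary.Any as Any using (Any; here; there; any?)
open import Data.List.Relation.Unary.AllPairs using (_∷_)
open import Data.List.Relation.Unary.Unique.Propositional using (Unique)
import Data.List.Relation.Unary.Unique.Propositional.Properties as Unique
open import Data.List.Membership.Propositional using (_∈_; _∉_; find)
open import Data.List.Membership.Propositional.Properties using (∈-∃++; ∈-++⁺ˡ)
open import Data.List.Relation.Binary.Permutation.Propositional as ↭ using (_↭_; ↭-sym; ↭-trans; ↭⇒↭ₛ)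
open import Data.List.Relation.Binary.Permutation.Propositional.Properties
  using (All-resp-↭; Any-resp-↭; ∈-resp-↭; ↭-length; shift; shifts; ++⁺ˡ)
open import Data.List.Relation.Binary.Permutation.Setoid.Properties using (Unique-resp-↭)
open import Data.Product using (_×_; _,_; ∃; proj₁; proj₂)
open import Data.Sum as Sum using (_⊎_; inj₁; inj₂)
open import Function using (case_of_)
open import Relation.Binary.PropositionalEquality
  using (_≡_; _≢_; refl; sym; trans; cong; cong₂; subst; subst₂; setoid; module ≡-Reasoning)
open import Relation.Nullary using (¬_; yes; no; contradiction)

private
  variable
    n : ℕ

-- Subsets of Fin n

∣p∪⁅x⁆∣≡1+∣p∣ : (p : Subset n) {x : Fin n} → x ∉ₛ p → ∣ p ∪ ⁅ x ⁆ ∣ ≡ suc ∣ p ∣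
∣p∪⁅x⁆∣≡1+∣p∣ (inside  ∷ p) {zero}  x∉p = contradiction here x∉p
∣p∪⁅x⁆∣≡1+∣p∣ (outside ∷ p) {zero}  x∉p = cong (λ q → suc ∣ q ∣) (∪-identityʳ p)
∣p∪⁅x⁆∣≡1+∣p∣ (inside  ∷ p) {suc x} x∉p = cong suc (∣p∪⁅x⁆∣≡1+∣p∣ p (λ x∈p → x∉p (there x∈p)))
∣p∪⁅x⁆∣≡1+∣p∣ (outside ∷ p) {suc x} x∉p = ∣p∪⁅x⁆∣≡1+∣p∣ p (λ x∈p → x∉p (there x∈p))

∣p∣≤1+∣p-x∣ : (p : Subset n) (x : Fin n) → ∣ p ∣ ≤ suc ∣ p - x ∣
∣p∣≤1+∣p-x∣ (inside  ∷ p) zero    = s≤s (≤-reflexive (cong ∣_∣ (sym (p─⊥≡p p))))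
∣p∣≤1+∣p-x∣ (outside ∷ p) zero    = ≤-trans (≤-reflexive (cong ∣_∣ (sym (p─⊥≡p p)))) (n≤1+n _)
∣p∣≤1+∣p-x∣ (inside  ∷ p) (suc x) = s≤s (∣p∣≤1+∣p-x∣ p x)
∣p∣≤1+∣p-x∣ (outside ∷ p) (suc x) = ∣p∣≤1+∣p-x∣ p x

x∉p-x : (p : Subset n) (x : Fin n) → x ∉ₛ p - x
x∉p-x (inside  ∷ p) zero    ()
x∉p-x (outside ∷ p) zero    ()
x∉p-x (s ∷ p)       (suc x) (there x∈p-x) = x∉p-x p x x∈p-x

0<∣p∣⇒Nonempty : (p : Subset n) → 0 < ∣ p ∣ → Nonempty p
0<∣p∣⇒Nonempty {n} p 0<∣p∣ with nonempty? p
... | yes ne = ne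
... | no ∅   = contradiction (subst (λ q → 0 < ∣ q ∣) (Empty-unique ∅) 0<∣p∣)
                             (λ 0<∣⊥∣ → <-irrefl (sym (∣⊥∣≡0 n)) 0<∣⊥∣)

∃∈p∉xs : (p : Subset n) (xs : List (Fin n)) → length xs < ∣ p ∣ → ∃ λ z → z ∈ₛ p × z ∉ xs
∃∈p∉xs p []       0<∣p∣ = let z , z∈p = 0<∣p∣⇒Nonempty p 0<∣p∣ in z , z∈p , λ ()
∃∈p∉xs p (x ∷ xs) xs<∣p∣ with ∃∈p∉xs (p - x) xs (s≤s⁻¹ (≤-trans xs<∣p∣ (∣p∣≤1+∣p-x∣ p x)))
... | z , z∈p-x , z∉xs = z , p─q⊆p p ⁅ x ⁆ z∈p-x , λ where
  (here refl)  → x∉p-x p x z∈p-x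
  (there z∈xs) → z∉xs z∈xs

∈∁∪⁅⁆⁻ : {p : Subset n} {x z : Fin n} → z ∈ₛ ∁ (p ∪ ⁅ x ⁆) → z ∈ₛ ∁ p × z ≢ x
∈∁∪⁅⁆⁻ {x = x} z∈ =
  x∉p⇒x∈∁p (λ z∈p → x∈∁p⇒x∉p z∈ (x∈p∪q⁺ (inj₁ z∈p))) ,
  λ { refl → x∈∁p⇒x∉p z∈ (x∈p∪q⁺ (inj₂ (x∈⁅x⁆ x))) }

∈∁∪⁅⁆⁺ : {p : Subset n} {x z : Fin n} → z ∈ₛ ∁ p → z ≢ x → z ∈ₛ ∁ (p ∪ ⁅ x ⁆)
∈∁∪⁅⁆⁺ {p = p} {x} z∈ z≢x = x∉p⇒x∈∁p λ z∈∪ →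
  Sum.[ x∈∁p⇒x∉p z∈ , (λ z∈⁅x⁆ → z≢x (x∈⁅y⁆⇒x≡y x z∈⁅x⁆)) ] (x∈p∪q⁻ p ⁅ x ⁆ z∈∪)

-- Matchings as lists of edges

Edge : ℕ → Set
Edge n = Fin n × Fin n

Adj : (G : Graph) → Edge (N G) → Set
Adj G (a , b) = _~_ G a b

_↾_ : (Edge n → Set) → (Fin n → Set) → Edge n → Set
(P ↾ Q) (a , b) = P (a , b) × Q a × Q b

IsMatchingIn : (Edge n → Set) → List (Edge n) → Set
IsMatchingIn P M = All P M × Unique (endpoints M)

SymmetricEdges : (Edge n → Set) → Set
SymmetricEdges P = ∀ {a b} → P (a , b) → P (b , a)

private
  variable
    P : Edge n → Set
    Q : Fin n → Set
    a b x z : Fin n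
    L L′ M M′ : List (Edge n)

∈∉⇒≢ : {xs : List (Fin n)} → z ∈ xs → x ∉ xs → z ≢ x
∈∉⇒≢ z∈ x∉ refl = x∉ z∈

length-endpoints : (L : List (Edge n)) → length (endpoints L) ≡ 2 * length L
length-endpoints []      = refl
length-endpoints (_ ∷ L) = trans (cong (2 +_) (length-endpoints L)) (sym (*-suc 2 (length L)))

endpoints-↭ : L ↭ L′ → endpoints L ↭ endpoints L′
endpoints-↭ ↭.refl                     = ↭.refl
endpoints-↭ (↭.prep (a , b) σ)         = ↭.prep a (↭.prep b (endpoints-↭ σ))
endpoints-↭ (↭.swap (a , b) (c , d) σ) =
  ↭-trans (shifts (a ∷ b ∷ []) (c ∷ d ∷ [])) (++⁺ˡ (c ∷ d ∷ a ∷ b ∷ []) (endpoints-↭ σ))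
endpoints-↭ (↭.trans σ τ)              = ↭-trans (endpoints-↭ σ) (endpoints-↭ τ)

matching-↭ : L ↭ L′ → IsMatchingIn P L → IsMatchingIn P L′
matching-↭ σ (all , unique) = All-resp-↭ σ all , Unique-resp-↭ (setoid _) (↭⇒↭ₛ (endpoints-↭ σ)) unique

matching-∷⁻ : IsMatchingIn P ((a , b) ∷ L) →
              P (a , b) × a ≢ b × a ∉ endpoints L × b ∉ endpoints L × IsMatchingIn P L
matching-∷⁻ (p ∷ all , (a≢b ∷ a∉) ∷ b∉ ∷ unique) = p , a≢b , All¬⇒¬Any a∉ , All¬⇒¬Any b∉ , all , unique

matching-∷⁺ : P (a , b) → a ≢ b → a ∉ endpoints L → b ∉ endpoints L → IsMatchingIn P L →
              IsMatchingIn P ((a , b) ∷ L)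
matching-∷⁺ p a≢b a∉ b∉ (all , unique) = p ∷ all , (a≢b ∷ ¬Any⇒All¬ _ a∉) ∷ ¬Any⇒All¬ _ b∉ ∷ unique

matching-++ : IsMatchingIn P M → IsMatchingIn P L → (∀ {z} → z ∈ endpoints L → z ∉ endpoints M) →
              IsMatchingIn P (M ++ L)
matching-++ {M = M} {L = L} (allM , uniqueM) (allL , uniqueL) disjoint =
  All-++⁺ allM allL ,
  subst Unique (sym (concatMap-++ _ M L))
        (Unique.++⁺ uniqueM uniqueL (λ (z∈M , z∈L) → disjoint z∈L z∈M))

↾-intro : (∀ {z} → z ∈ endpoints L → Q z) → All P L → All (P ↾ Q) L
↾-intro {L = []}    q []       = []
↾-intro {L = _ ∷ _} q (p ∷ ps) =
  (p , q (here refl) , q (there (here refl))) ∷ ↾-intro (λ z∈ → q (there (there z∈))) ps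

↾-endpoints : All (P ↾ Q) L → z ∈ endpoints L → Q z
↾-endpoints ((_ , qa , _) ∷ _) (here refl)         = qa
↾-endpoints ((_ , _ , qb) ∷ _) (there (here refl)) = qb
↾-endpoints (_ ∷ ps)           (there (there z∈))  = ↾-endpoints ps z∈

↾-sym : SymmetricEdges P → SymmetricEdges (P ↾ Q)
↾-sym sym-P (p , qa , qb) = sym-P p , qb , qa

∈-endpoints⇒edge : SymmetricEdges P → All P L → x ∈ endpoints L →
                   ∃ λ y → P (x , y) × Any (SamePair (x , y)) L
∈-endpoints⇒edge {L = (_ , b) ∷ _} _     (p ∷ _) (here refl)         = b , p , here (inj₁ (refl , refl))
∈-endpoints⇒edge {L = (a , _) ∷ _} sym-P (p ∷ _) (there (here refl)) = a , sym-P p , here (inj₂ (refl , refl))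
∈-endpoints⇒edge sym-P (_ ∷ ps) (there (there x∈)) =
  let y , p , same = ∈-endpoints⇒edge sym-P ps x∈ in y , p , there same

¬SamePair : a ≢ x → b ≢ x → ¬ SamePair (a , b) (x , z)
¬SamePair a≢x _   (inj₁ (a≡x , _)) = a≢x a≡x
¬SamePair _   b≢x (inj₂ (_ , b≡x)) = b≢x b≡x

record Removal (P : Edge n → Set) (L : List (Edge n)) (a b : Fin n) : Set where
  field
    rest           : List (Edge n)
    length-rest    : length L ≡ suc (length rest)
    matching-rest  : IsMatchingIn P rest
    a∉rest         : a ∉ endpoints rest
    b∉rest         : b ∉ endpoints rest
    endpoints-rest : endpoints L ↭ a ∷ b ∷ endpoints rest
    other-edge     : ∀ {e} → Any (SamePair e) L → SamePair e (a , b) ⊎ Any (SamePair e) rest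

  rest⊆ : ∀ {z} → z ∈ endpoints rest → z ∈ endpoints L
  rest⊆ z∈ = ∈-resp-↭ (↭-sym endpoints-rest) (there (there z∈))

  b∈L : b ∈ endpoints L
  b∈L = ∈-resp-↭ (↭-sym endpoints-rest) (there (here refl))

removal : {e : Edge n} → SamePair (a , b) e → L ↭ e ∷ L′ → IsMatchingIn P L → Removal P L a b
removal {L′ = L′} (inj₁ (refl , refl)) σ matching =
  let _ , _ , a∉ , b∉ , matching′ = matching-∷⁻ (matching-↭ σ matching) in record
    { rest = L′ ; length-rest = ↭-length σ ; matching-rest = matching′ ; a∉rest = a∉ ; b∉rest = b∉
    ; endpoints-rest = endpoints-↭ σ
    ; other-edge = λ same → case Any-resp-↭ σ same of λ where
        (here s)  → inj₁ s
        (there s) → inj₂ s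
    }
removal {a = a} {b} {L′ = L′} (inj₂ (refl , refl)) σ matching =
  let _ , _ , b∉ , a∉ , matching′ = matching-∷⁻ (matching-↭ σ matching) in record
    { rest = L′ ; length-rest = ↭-length σ ; matching-rest = matching′ ; a∉rest = a∉ ; b∉rest = b∉
    ; endpoints-rest = ↭-trans (endpoints-↭ σ) (↭.swap b a ↭.refl)
    ; other-edge = λ same → case Any-resp-↭ σ same of λ where
        (here s)  → inj₁ (Sum.swap s)
        (there s) → inj₂ s
    }

remove-edge : IsMatchingIn P L → Any (SamePair (a , b)) L → Removal P L a b
remove-edge matching same with find same
... | e , e∈L , same-e with ∈-∃++ e∈L
... | xs , ys , refl = removal same-e (shift e xs ys) matching

record Remainder (P : Edge n → Set) (M M′ : List (Edge n)) : Set where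
  field
    extra          : List (Edge n)
    matching-extra : IsMatchingIn P extra
    length-extra   : length M′ ≡ length M + length extra
    extra∉M        : ∀ {z} → z ∈ endpoints extra → z ∉ endpoints M
    extra⊆M′       : ∀ {z} → z ∈ endpoints extra → z ∈ endpoints M′

remainder : IsMatchingIn P M′ → Unique (endpoints M) → Extends M M′ → Remainder P M M′
remainder {M′ = M′} matching _ [] = record
  { extra = M′ ; matching-extra = matching ; length-extra = refl ; extra∉M = λ _ () ; extra⊆M′ = λ z∈ → z∈ }
remainder {M = (a , b) ∷ M} matching ((_ ∷ a∉M) ∷ b∉M ∷ uniqueM) (same ∷ extends) = record
  { extra          = extra
  ; matching-extra = matching-extra
  ; length-extra   = trans length-rest (cong suc length-extra)
  ; extra∉M        = λ where
      z∈ (here refl)         → a∉rest (extra⊆M′ z∈)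
      z∈ (there (here refl)) → b∉rest (extra⊆M′ z∈)
      z∈ (there (there z∈M)) → extra∉M z∈ z∈M
  ; extra⊆M′       = λ z∈ → rest⊆ (extra⊆M′ z∈)
  }
  where
    open Removal (remove-edge matching same)
    ≢a : ∀ {z} → z ∈ endpoints M → z ≢ a
    ≢a z∈M refl = All¬⇒¬Any a∉M z∈M
    extends-rest : Extends M rest
    extends-rest = All.map (λ (s , e₁≢a , e₂≢a) → Sum.[ (λ s′ → contradiction s′ (¬SamePair e₁≢a e₂≢a)) , (λ s′ → s′) ]
                                                       (other-edge s))
                           (↾-intro ≢a extends)
    open Remainder (remainder matching-rest uniqueM extends-rest)

Extends-++ : (M L : List (Edge n)) → Extends M (M ++ L)
Extends-++ M L = All.tabulate (λ e∈M → Any.map (λ { refl → inj₁ (refl , refl) }) (∈-++⁺ˡ e∈M))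

-- Alternating paths in a bipartite graph

module _ {n : ℕ} (colour : Fin n → Bool) where

  ProperlyColoured : (Edge n → Set) → Set
  ProperlyColoured P = ∀ {a b} → P (a , b) → colour a ≢ colour b

  Augmented : (Edge n → Set) → ℕ → Set
  Augmented P r = ∃ λ W → IsMatchingIn P W × length W ≡ suc r

  Rerouted : (Edge n → Set) → ℕ → List (Edge n) → Fin n → Set
  Rerouted P r Y w = ∃ λ Y′ → IsMatchingIn P Y′ × length Y′ ≡ r × w ∉ endpoints Y′ ×
                       (∀ {z} → z ∈ endpoints Y′ → colour z ≢ colour w → z ∈ endpoints Y)

  -- If Y matches w to y, either X + wy is larger or X matches y to some x on the side of w; then recurse on
  -- X − yx and Y − wy with x in place of w, and add wy to an augmented matching or xy to a rerouted one.
  augment : ∀ r {P : Edge n → Set} {X Y : List (Edge n)} {w : Fin n} →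
            SymmetricEdges P → ProperlyColoured P → IsMatchingIn P X → IsMatchingIn P Y →
            length X ≡ r → length Y ≡ r → w ∉ endpoints X → Augmented P r ⊎ Rerouted P r Y w
  augment r {P} {X} {Y} {w} sym-P proper matchX matchY |X| |Y| w∉X with any? (w ≟_) (endpoints Y)
  ... | no w∉Y = inj₂ (Y , matchY , |Y| , w∉Y , λ z∈ _ → z∈)
  ... | yes w∈Y with ∈-endpoints⇒edge {L = Y} sym-P (proj₁ matchY) w∈Y
  ... | y , p-wy , same-wy with any? (y ≟_) (endpoints X)
  ... | no y∉X = inj₁ ((w , y) ∷ X , matching-∷⁺ p-wy w≢y w∉X y∉X matchX , cong suc |X|)
    where w≢y = λ w≡y → proper p-wy (cong colour w≡y)
  ... | yes y∈X with ∈-endpoints⇒edge {L = X} sym-P (proj₁ matchX) y∈X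
  ... | x , p-yx , same-yx = follow r |X| |Y|
    where
      module X₁ = Removal (remove-edge matchX same-yx)
      module Y₁ = Removal (remove-edge matchY same-wy)

      Avoid : Fin n → Set
      Avoid z = z ≢ w × z ≢ y

      colour-x≡colour-w : colour x ≡ colour w
      colour-x≡colour-w = trans (¬-not (λ e → proper p-yx (sym e))) (sym (¬-not (proper p-wy)))

      restrict : {L : List (Edge n)} → (∀ {z} → z ∈ endpoints L → Avoid z) →
                 IsMatchingIn P L → IsMatchingIn (P ↾ Avoid) L
      restrict avoid (all , unique) = ↾-intro avoid all , unique

      unrestrict : {L : List (Edge n)} → IsMatchingIn (P ↾ Avoid) L → IsMatchingIn P L
      unrestrict (all , unique) = All.map proj₁ all , unique

      avoid-X₁ : ∀ {z} → z ∈ endpoints X₁.rest → Avoid z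
      avoid-X₁ z∈ = ∈∉⇒≢ (X₁.rest⊆ z∈) w∉X , ∈∉⇒≢ z∈ X₁.a∉rest

      avoid-Y₁ : ∀ {z} → z ∈ endpoints Y₁.rest → Avoid z
      avoid-Y₁ z∈ = ∈∉⇒≢ z∈ Y₁.a∉rest , ∈∉⇒≢ z∈ Y₁.b∉rest

      prepend-wy : ∀ {r′} → Augmented (P ↾ Avoid) r′ → Augmented P (suc r′)
      prepend-wy (W , matchW , |W|) =
        (w , y) ∷ W ,
        matching-∷⁺ p-wy (λ w≡y → proper p-wy (cong colour w≡y))
                    (λ w∈ → proj₁ (↾-endpoints (proj₁ matchW) w∈) refl)
                    (λ y∈ → proj₂ (↾-endpoints (proj₁ matchW) y∈) refl)
                    (unrestrict matchW) ,
        cong suc |W|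

      prepend-xy : ∀ {r′} → Rerouted (P ↾ Avoid) r′ Y₁.rest x → Rerouted P (suc r′) Y w
      prepend-xy (Y′ , matchY′ , |Y′| , x∉Y′ , covers) =
        (x , y) ∷ Y′ ,
        matching-∷⁺ (sym-P p-yx) (λ x≡y → proper p-yx (cong colour (sym x≡y))) x∉Y′ y∉Y′ (unrestrict matchY′) ,
        cong suc |Y′| ,
        w∉ ,
        covers′
        where
          y∉Y′ : y ∉ endpoints Y′
          y∉Y′ y∈ = proj₂ (↾-endpoints (proj₁ matchY′) y∈) refl
          w∉ : w ∉ endpoints ((x , y) ∷ Y′)
          w∉ (here refl)         = w∉X X₁.b∈L
          w∉ (there (here refl)) = proper p-wy refl
          w∉ (there (there w∈))  = proj₁ (↾-endpoints (proj₁ matchY′) w∈) refl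
          covers′ : ∀ {z} → z ∈ endpoints ((x , y) ∷ Y′) → colour z ≢ colour w → z ∈ endpoints Y
          covers′ (here refl)         c≢ = contradiction colour-x≡colour-w c≢
          covers′ (there (here refl)) _  = Y₁.b∈L
          covers′ (there (there z∈))  c≢ = Y₁.rest⊆ (covers z∈ (λ c≡ → c≢ (trans c≡ colour-x≡colour-w)))

      follow : ∀ r → length X ≡ r → length Y ≡ r → Augmented P r ⊎ Rerouted P r Y w
      follow zero     |X| _   = contradiction (trans (sym X₁.length-rest) |X|) λ ()
      follow (suc r′) |X| |Y| =
        Sum.map prepend-wy prepend-xy
          (augment r′ (↾-sym {Q = Avoid} sym-P) (λ (p , _) → proper p)
                   (restrict avoid-X₁ X₁.matching-rest) (restrict avoid-Y₁ Y₁.matching-rest)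
                   (suc-injective (trans (sym X₁.length-rest) |X|))
                   (suc-injective (trans (sym Y₁.length-rest) |Y|))
                   X₁.b∉rest)

-- Deleting an edge

module Deletion {n k d : ℕ} (G : Graph) (colour : Fin (N G) → Bool)
                (proper : ∀ {x y} → _~_ G x y → colour x ≢ colour y)
                (nkd : IsNKDGraph (2 + n) k d G) (u v : Fin (N G)) where

  open ≡-Reasoning

  Vertex : Set
  Vertex = Fin (N G)

  G′ : Graph
  G′ = removeEdge G u v

  order-bound : N G ≥ 2 + n + 2 * k + d + 2
  order-bound = proj₁ nkd

  order-bound′ : N G ≥ n + 2 * k + d + 2
  order-bound′ = ≤-trans (m≤n+m _ 2) order-bound

  matchable : ∀ T → ∣ T ∣ ≡ 2 + n →
    (∃ λ M → IsMatching G (∁ T) M × length M ≡ k) ×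
    (∀ M → IsMatching G (∁ T) M → length M ≡ k → ∃ λ M′ → IsDefectMatching G (∁ T) d M′ × Extends M M′)
  matchable = proj₂ (proj₂ nkd)

  -- the number of vertices of G − T whenever |T| = n + 2
  q : ℕ
  q = N G ∸ (2 + n)

  N∸n≡2+q : N G ∸ n ≡ 2 + q
  N∸n≡2+q = begin
    N G ∸ n          ≡⟨ cong (_∸ n) (sym (m+[n∸m]≡n 2+n≤N)) ⟩
    2 + n + q ∸ n    ≡⟨ cong (_∸ n) (shuffle n q) ⟩
    n + (2 + q) ∸ n  ≡⟨ m+n∸m≡n n (2 + q) ⟩
    2 + q            ∎
    where
      2+n≤N : 2 + n ≤ N G
      2+n≤N = m+n≤o⇒m≤o (2 + n) (m+n≤o⇒m≤o (2 + n + 2 * k) (m+n≤o⇒m≤o (2 + n + 2 * k + d) order-bound))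
      shuffle : ∀ n q → 2 + n + q ≡ n + (2 + q)
      shuffle = solve-∀

  2k+d+2≤q : 2 * k + d + 2 ≤ q
  2k+d+2≤q = m+n≤o⇒m≤o∸n (2 * k + d + 2) (≤-trans (≤-reflexive (shuffle n k d)) order-bound)
    where
      shuffle : ∀ n k d → 2 * k + d + 2 + (2 + n) ≡ 2 + n + 2 * k + d + 2
      shuffle = solve-∀

  q≢2k+d : q ≢ 2 * (k + 0) + d
  q≢2k+d q≡ =
    m+1+n≰m (2 * k + d) (subst (2 * k + d + 2 ≤_) (trans q≡ (cong (λ t → 2 * t + d) (+-identityʳ k))) 2k+d+2≤q)

  size-injective : ∀ {r r′} → 2 * (k + r) + d ≡ 2 * (k + r′) + d → r ≡ r′
  size-injective {r} {r′} eq = +-cancelˡ-≡ k r r′ (*-cancelˡ-≡ (k + r) (k + r′) 2 (+-cancelʳ-≡ d _ _ eq))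

  parity : 2 ∣ N G ∸ n ∸ d
  parity = subst (2 ∣_) (sym (trans (cong (_∸ d) N∸n≡2+q) (+-∸-assoc 2 d≤q)))
                 (∣m∣n⇒∣m+n ∣-refl (proj₁ (proj₂ nkd)))
    where d≤q = m+n≤o⇒n≤o (2 * k) (m+n≤o⇒m≤o (2 * k + d) 2k+d+2≤q)

  ∣∁S∣≡2+q : {S : Subset (N G)} → ∣ S ∣ ≡ n → ∣ ∁ S ∣ ≡ 2 + q
  ∣∁S∣≡2+q {S} |S| = trans (∣∁p∣≡n∸∣p∣ S) (trans (cong (N G ∸_) |S|) N∸n≡2+q)

  ∣∁T∣≡q : {T : Subset (N G)} → ∣ T ∣ ≡ 2 + n → ∣ ∁ T ∣ ≡ q
  ∣∁T∣≡q {T} |T| = trans (∣∁p∣≡n∸∣p∣ T) (cong (N G ∸_) |T|)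

  ∣S∪⁅w⁆∪⁅x⁆∣ : {S : Subset (N G)} {w x : Vertex} → ∣ S ∣ ≡ n → w ∈ₛ ∁ S → x ∈ₛ ∁ S → x ≢ w →
                ∣ (S ∪ ⁅ w ⁆) ∪ ⁅ x ⁆ ∣ ≡ 2 + n
  ∣S∪⁅w⁆∪⁅x⁆∣ {S} {w} |S| w∈ x∈ x≢w =
    trans (∣p∪⁅x⁆∣≡1+∣p∣ (S ∪ ⁅ w ⁆) (x∈∁p⇒x∉p (∈∁∪⁅⁆⁺ x∈ x≢w)))
          (cong suc (trans (∣p∪⁅x⁆∣≡1+∣p∣ S (x∈∁p⇒x∉p w∈)) (cong suc |S|)))

  ∈∁S∪⁅w⁆∪⁅x⁆⁻ : {S : Subset (N G)} {w x z : Vertex} →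
                 z ∈ₛ ∁ ((S ∪ ⁅ w ⁆) ∪ ⁅ x ⁆) → z ∈ₛ ∁ S × z ≢ w × z ≢ x
  ∈∁S∪⁅w⁆∪⁅x⁆⁻ z∈ = let z∈′ , z≢x = ∈∁∪⁅⁆⁻ z∈ ; z∈S , z≢w = ∈∁∪⁅⁆⁻ z∈′ in z∈S , z≢w , z≢x

  ∈∁S∪⁅w⁆∪⁅x⁆⁺ : {S : Subset (N G)} {w x z : Vertex} →
                 z ∈ₛ ∁ S → z ≢ w → z ≢ x → z ∈ₛ ∁ ((S ∪ ⁅ w ⁆) ∪ ⁅ x ⁆)
  ∈∁S∪⁅w⁆∪⁅x⁆⁺ z∈S z≢w z≢x = ∈∁∪⁅⁆⁺ (∈∁∪⁅⁆⁺ z∈S z≢w) z≢x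

  G′-edge : ∀ {a b} → _~_ G a b → a ≢ u → b ≢ u → _~_ G′ a b
  G′-edge g a≢u b≢u = g , ¬SamePair a≢u b≢u

  -- Taking w = u whenever u is available makes every other available vertex differ from u, so the edges of G
  -- that avoid S, L and w are edges of G′.
  record Pivots (S : Subset (N G)) (L : List Vertex) : Set where
    field
      w w′      : Vertex
      w∈        : w ∈ₛ ∁ S
      w∉        : w ∉ L
      w′∈       : w′ ∈ₛ ∁ S
      w′∉       : w′ ∉ L
      w′≢w      : w′ ≢ w
      u-free⇒≡w : u ∈ₛ ∁ S → u ∉ L → u ≡ w

    ≢w⇒≢u : ∀ {z} → z ∈ₛ ∁ S → z ∉ L → z ≢ w → z ≢ u
    ≢w⇒≢u z∈ z∉ z≢w refl = z≢w (u-free⇒≡w z∈ z∉)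

  first-pivot : ∀ S L → 1 + length L ≤ ∣ ∁ S ∣ →
                ∃ λ w → w ∈ₛ ∁ S × w ∉ L × (u ∈ₛ ∁ S → u ∉ L → u ≡ w)
  first-pivot S L room with u ∈? ∁ S | any? (u ≟_) L
  ... | yes u∈ | no u∉   = u , u∈ , u∉ , λ _ _ → refl
  ... | no u∉S | _       = let w , w∈ , w∉ = ∃∈p∉xs (∁ S) L room in w , w∈ , w∉ , λ u∈ _ → contradiction u∈ u∉S
  ... | yes _  | yes u∈L = let w , w∈ , w∉ = ∃∈p∉xs (∁ S) L room in w , w∈ , w∉ , λ _ u∉ → contradiction u∈L u∉

  pivots : ∀ S L → 2 + length L ≤ ∣ ∁ S ∣ → Pivots S L
  pivots S L room with first-pivot S L (≤-trans (n≤1+n _) room)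
  ... | w , w∈ , w∉ , u-free⇒≡w with ∃∈p∉xs (∁ S) (w ∷ L) room
  ... | w′ , w′∈ , w′∉w∷L = record
    { w = w ; w′ = w′ ; w∈ = w∈ ; w∉ = w∉ ; w′∈ = w′∈
    ; w′∉ = λ w′∈L → w′∉w∷L (there w′∈L) ; w′≢w = λ w′≡w → w′∉w∷L (here w′≡w) ; u-free⇒≡w = u-free⇒≡w }

  k-matching : ∀ S → ∣ S ∣ ≡ n → ∃ λ M → IsMatching G′ (∁ S) M × length M ≡ k
  k-matching S |S| = transfer (proj₁ (matchable T (∣S∪⁅w⁆∪⁅x⁆∣ |S| w∈ w′∈ w′≢w)))
    where
      open Pivots (pivots S [] (subst (2 ≤_) (sym (∣∁S∣≡2+q {S} |S|)) (m≤m+n 2 q)))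
      T = (S ∪ ⁅ w ⁆) ∪ ⁅ w′ ⁆
      into-G′ : ∀ {e} → (Adj G ↾ (_∈ₛ ∁ T)) e → (Adj G′ ↾ (_∈ₛ ∁ S)) e
      into-G′ (g , a∈ , b∈) =
        let a∈S , a≢w , _ = ∈∁S∪⁅w⁆∪⁅x⁆⁻ a∈ ; b∈S , b≢w , _ = ∈∁S∪⁅w⁆∪⁅x⁆⁻ b∈
        in G′-edge g (≢w⇒≢u a∈S (λ ()) a≢w) (≢w⇒≢u b∈S (λ ()) b≢w) , a∈S , b∈S
      transfer : (∃ λ K → IsMatching G (∁ T) K × length K ≡ k) → ∃ λ K → IsMatching G′ (∁ S) K × length K ≡ k
      transfer (K , (allK , uniqueK) , |K|) = K , (All.map into-G′ allK , uniqueK) , |K|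

  module Extension (S : Subset (N G)) (|S| : ∣ S ∣ ≡ n) (M : List (Edge (N G)))
                   (matchM : IsMatching G′ (∁ S) M) (|M| : length M ≡ k) where

    DefectExtension : Set
    DefectExtension = ∃ λ M′ → IsDefectMatching G′ (∁ S) d M′ × Extends M M′

    room : 2 + length (endpoints M) ≤ ∣ ∁ S ∣
    room = subst₂ (λ a b → 2 + a ≤ b) (sym (trans (length-endpoints M) (cong (2 *_) |M|))) (sym (∣∁S∣≡2+q {S} |S|))
                  (s≤s (s≤s (m+n≤o⇒m≤o (2 * k) (m+n≤o⇒m≤o (2 * k + d) 2k+d+2≤q))))

    open Pivots (pivots S (endpoints M) room)

    Free : Edge (N G) → Set
    Free = (Adj G′ ↾ (_∈ₛ ∁ S)) ↾ (_∉ endpoints M)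

    Free-symmetric : SymmetricEdges Free
    Free-symmetric = ↾-sym {Q = _∉ endpoints M} (↾-sym {Q = _∈ₛ ∁ S} (Graph.sym G′))

    Free-proper : ProperlyColoured colour Free
    Free-proper (((g , _) , _) , _) = proper g

    record Completion (x : Vertex) : Set where
      field
        edges    : List (Edge (N G))
        matching : IsMatchingIn Free edges
        size     : q ≡ 2 * (k + length edges) + d
        w∉edges  : w ∉ endpoints edges
        x∉edges  : x ∉ endpoints edges

    completion : ∀ {x} → x ∈ₛ ∁ S → x ∉ endpoints M → x ≢ w → Completion x
    completion {x} x∈ x∉M x≢w = from-extension (proj₂ (matchable T |T|) M matchM-T |M|)
      where
        T = (S ∪ ⁅ w ⁆) ∪ ⁅ x ⁆
        |T| = ∣S∪⁅w⁆∪⁅x⁆∣ |S| w∈ x∈ x≢w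
        ∈∁T : ∀ {z} → z ∈ₛ ∁ S → z ∈ endpoints M → z ∈ₛ ∁ T
        ∈∁T z∈ z∈M = ∈∁S∪⁅w⁆∪⁅x⁆⁺ z∈ (∈∉⇒≢ z∈M w∉) (∈∉⇒≢ z∈M x∉M)
        matchM-T : IsMatching G (∁ T) M
        matchM-T = All.map (λ (((g , _) , a∈ , b∈) , a∈M , b∈M) → g , ∈∁T a∈ a∈M , ∈∁T b∈ b∈M)
                           (↾-intro {Q = _∈ endpoints M} (λ z∈ → z∈) (proj₁ matchM)) ,
                   proj₂ matchM
        into-Free : ∀ {e} → ((Adj G ↾ (_∈ₛ ∁ T)) ↾ (_∉ endpoints M)) e → Free e
        into-Free ((g , a∈ , b∈) , a∉ , b∉) =
          let a∈S , a≢w , _ = ∈∁S∪⁅w⁆∪⁅x⁆⁻ a∈ ; b∈S , b≢w , _ = ∈∁S∪⁅w⁆∪⁅x⁆⁻ b∈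
          in (G′-edge g (≢w⇒≢u a∈S a∉ a≢w) (≢w⇒≢u b∈S b∉ b≢w) , a∈S , b∈S) , a∉ , b∉
        from-extension : (∃ λ M′ → IsDefectMatching G (∁ T) d M′ × Extends M M′) → Completion x
        from-extension (M′ , ((allM′ , uniqueM′) , defect) , extends) = record
          { edges    = extra
          ; matching = All.map into-Free (↾-intro extra∉M (proj₁ matching-extra)) , proj₂ matching-extra
          ; size     = begin
              q                           ≡⟨ sym (∣∁T∣≡q {T} |T|) ⟩
              ∣ ∁ T ∣                      ≡⟨ defect ⟩
              length (endpoints M′) + d   ≡⟨ cong (_+ d) (length-endpoints M′) ⟩
              2 * length M′ + d           ≡⟨ cong (λ m → 2 * m + d) (trans length-extra (cong (_+ length extra) |M|)) ⟩
              2 * (k + length extra) + d  ∎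
          ; w∉edges  = λ w∈X → proj₁ (proj₂ (∈∁S∪⁅w⁆∪⁅x⁆⁻ (↾-endpoints (proj₁ matching-extra) w∈X))) refl
          ; x∉edges  = λ x∈X → proj₂ (proj₂ (∈∁S∪⁅w⁆∪⁅x⁆⁻ (↾-endpoints (proj₁ matching-extra) x∈X))) refl
          }
          where open Remainder (remainder (allM′ , uniqueM′) (proj₂ matchM) extends)

    complete : ∀ {r} W → IsMatchingIn Free W → length W ≡ suc r → q ≡ 2 * (k + r) + d → DefectExtension
    complete {r} W (allW , uniqueW) |W| size =
      M ++ W , (matching-++ matchM (All.map proj₁ allW , uniqueW) (↾-endpoints allW) , count) , Extends-++ M W
      where
        shuffle : ∀ k r d → 2 + (2 * (k + r) + d) ≡ 2 * (k + suc r) + d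
        shuffle = solve-∀
        count : ∣ ∁ S ∣ ≡ length (endpoints (M ++ W)) + d
        count = begin
          ∣ ∁ S ∣                            ≡⟨ ∣∁S∣≡2+q {S} |S| ⟩
          2 + q                             ≡⟨ cong (2 +_) size ⟩
          2 + (2 * (k + r) + d)             ≡⟨ shuffle k r d ⟩
          2 * (k + suc r) + d               ≡⟨ cong (λ m → 2 * m + d) (sym (trans (length-++ M) (cong₂ _+_ |M| |W|))) ⟩
          2 * length (M ++ W) + d           ≡⟨ cong (_+ d) (sym (length-endpoints (M ++ W))) ⟩
          length (endpoints (M ++ W)) + d   ∎

    free-edge : ∃ λ x → ∃ λ y → Free (x , y) × x ≢ w × y ≢ w
    free-edge = first-edge edges matching size w∉edges
      where
        open Completion (completion w′∈ w′∉ w′≢w)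
        first-edge : ∀ X → IsMatchingIn Free X → q ≡ 2 * (k + length X) + d → w ∉ endpoints X →
                     ∃ λ x → ∃ λ y → Free (x , y) × x ≢ w × y ≢ w
        first-edge []            _             size _   = contradiction size q≢2k+d
        first-edge ((x , y) ∷ _) ((p ∷ _) , _) _    w∉X =
          x , y , p , (λ { refl → w∉X (here refl) }) , (λ { refl → w∉X (there (here refl)) })

    defect-extension : DefectExtension
    defect-extension = let x , y , p , x≢w , y≢w = free-edge in via-edge x y p x≢w y≢w
      where
        via-edge : ∀ x y → Free (x , y) → x ≢ w → y ≢ w → DefectExtension
        via-edge x y p@((_ , x∈ , y∈) , x∉M , y∉M) x≢w y≢w =
          Sum.[ (λ (W , matchW , |W|) → complete W matchW |W| X.size) , rerouted ]′
            (augment colour (length X.edges) Free-symmetric Free-proper X.matching Y.matching refl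
                     (size-injective (trans (sym Y.size) X.size)) X.x∉edges)
          where
            module X = Completion (completion x∈ x∉M x≢w)
            module Y = Completion (completion y∈ y∉M y≢w)
            rerouted : Rerouted colour Free (length X.edges) Y.edges x → DefectExtension
            rerouted (Y′ , matchY′ , |Y′| , x∉Y′ , covers) =
              complete ((x , y) ∷ Y′)
                       (matching-∷⁺ p (λ x≡y → Free-proper p (cong colour x≡y)) x∉Y′ y∉Y′ matchY′)
                       (cong suc |Y′|) X.size
              where
                y∉Y′ : y ∉ endpoints Y′
                y∉Y′ y∈ = Y.x∉edges (covers y∈ (λ c → Free-proper p (sym c)))

-- The argument does not use that uv is an edge of G.
theorem4p2 : (n k d : ℕ) → n ≥ 2 → (G : Graph) → Bipartite G → IsNKDGraph n k d G →
    ∀ u v → _~_ G u v → IsNKDGraph (n ∸ 2) k d (removeEdge G u v)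
theorem4p2 zero          _ _ ()       _ _ _ _ _ _
theorem4p2 (suc zero)    _ _ (s≤s ()) _ _ _ _ _ _
theorem4p2 (suc (suc n)) k d _ G (colour , proper) nkd u v _ =
  order-bound′ , parity , λ S |S| → k-matching S |S| , Extension.defect-extension S |S|
  where open Deletion G colour proper nkd u v
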